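{- Let $k\geq 1$, $n=8k+3$, $G=C(n,\pm\{1,2,3,4\})$, and $a\in\mathbb{Z}_n$. If $X\subseteq V(G)$ resolves $A=\{a,a+1,a+5,a+6\}$ (indices mod $n$), then $|X|\geq 2$.
   Context: $C(n,\pm\{1,2,3,4\})$ is the graph on $\mathbb{Z}_n$ where distinct $i,j$ are adjacent iff $j-i\equiv\pm s\pmod n$ for some $s\in\{1,2,3,4\}$; $d$ is graph distance, and $r(v|X)=(d(v,x))_{x\in X}$. A set $X$ resolves a set $A$ if $r(a|X)\neq r(b|X)$ for all distinct $a,b\in A$. -}

module Defs where

open import Data.Nat using (ℕ; zero; suc; _+_; _*_; _∸_; _≤_; NonZero)
open import Data.Nat.DivMod using (_%_; m%n<n)
open import Data.Fin using (Fin; toℕ; fromℕ<)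
open import Data.Fin.Subset using (Subset; _∈_)
open import Data.Product using (Σ; _×_)
open import Data.Sum using (_⊎_)
open import Relation.Binary.PropositionalEquality using (_≡_; _≢_)
open import Relation.Nullary using (¬_)

diffMod : (n : ℕ) → .{{_ : NonZero n}} → Fin n → Fin n → ℕ
diffMod n i j = (toℕ j + (n ∸ toℕ i)) % n

data GenDiff (n : ℕ) .{{_ : NonZero n}} (i j : Fin n) : Set where
  plus  : (s : ℕ) → 1 ≤ s → s ≤ 4 → diffMod n i j ≡ s % n → GenDiff n i j
  minus : (s : ℕ) → 1 ≤ s → s ≤ 4 → diffMod n i j ≡ (n ∸ s) % n → GenDiff n i j

Adj : (n : ℕ) → .{{_ : NonZero n}} → Fin n → Fin n → Set
Adj n i j = (i ≢ j) × GenDiff n i j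

data Walk (n : ℕ) .{{_ : NonZero n}} : Fin n → Fin n → ℕ → Set where
  here : (v : Fin n) → Walk n v v 0
  step : {u v w : Fin n} {m : ℕ} → Adj n u v → Walk n v w m → Walk n u w (suc m)

Dist : (n : ℕ) → .{{_ : NonZero n}} → Fin n → Fin n → ℕ → Set
Dist n u v m = Walk n u v m × ((m' : ℕ) → Walk n u v m' → m ≤ m')

shift : (n : ℕ) → .{{_ : NonZero n}} → Fin n → ℕ → Fin n
shift n a t = fromℕ< (m%n<n (toℕ a + t) n)

SameRep : (n : ℕ) → .{{_ : NonZero n}} → Subset n → Fin n → Fin n → Set
SameRep n X u v = (x : Fin n) → x ∈ X → (m : ℕ) → (Dist n u x m → Dist n v x m) × (Dist n v x m → Dist n u x m)

InA : (n : ℕ) → .{{_ : NonZero n}} → Fin n → Fin n → Set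
InA n a v = (v ≡ shift n a 0) ⊎ ((v ≡ shift n a 1) ⊎ ((v ≡ shift n a 5) ⊎ (v ≡ shift n a 6)))

Resolves : (n : ℕ) → .{{_ : NonZero n}} → Subset n → (Fin n → Set) → Set
Resolves n X A = (u v : Fin n) → A u → A v → u ≢ v → ¬ SameRep n X u v

-- In C(n, ±{1,2,3,4}) two vertices whose difference is g (mod n) are at distance
-- ⌈min(g, n - g)/4⌉: an edge changes min(g, n - g) by at most 4, and steps of 4 attain the bound.
-- For n = 8k + 3 = 2h + 1 the distances from a landmark x to x + s thus run 0; four each of
-- 1, …, k; two of k + 1; four each of k, …, 1. They differ at s and s + 1 only when s is a
-- multiple of 4 (for s ≤ h) or n - s - 1 is (for s > h). Chasing this through the offsets
-- t, t + 1, t + 5, t + 6 of A from x shows that the pair (t, t + 1) or (t + 5, t + 6) agrees,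
-- except for t = n - 1 and t = n - 5, where (t, t + 5), respectively (t + 1, t + 6), does.
-- So one landmark never resolves A.

module Submission where

open import Defs
open import Data.Nat
open import Data.Nat.Properties
open import Data.Nat.DivMod
open import Data.Nat.Divisibility using (m%n≡0⇒n∣m)
open import Data.Nat.Tactic.RingSolver using (solve-∀)
open import Data.Fin as Fin using (Fin; toℕ)
open import Data.Fin.Properties using (toℕ-injective; toℕ<n; toℕ-fromℕ<)
open import Data.Fin.Subset using (Subset; ∣_∣; _∈_; _⊆_; ⁅_⁆; _-_)
open import Data.Fin.Subset.Properties
  using (x∈⁅y⁆⇒x≡y; x∈⁅y⁆⇔x≡y; nonempty?; ∣⁅x⁆∣≡1; p⊆q⇒∣p∣≤∣q∣;
         x∈p∧x≢y⇒x∈p-y; x∈p⇒∣p-x∣<∣p∣)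
open import Data.Product using (Σ; _×_; _,_)
open import Data.Sum using (_⊎_; inj₁; inj₂)
open import Data.Empty using (⊥; ⊥-elim)
open import Function.Base using (_∘_)
open import Function.Bundles using (Equivalence)
open import Relation.Nullary using (yes; no)
open import Relation.Binary.PropositionalEquality

⌈_/4⌉ : ℕ → ℕ
⌈ 0 /4⌉ = 0
⌈ 1 /4⌉ = 1
⌈ 2 /4⌉ = 1
⌈ 3 /4⌉ = 1
⌈ 4 /4⌉ = 1
⌈ suc (suc (suc (suc (suc d)))) /4⌉ = suc ⌈ suc d /4⌉

⌈/4⌉-least : ∀ d m → d ≤ m * 4 → ⌈ d /4⌉ ≤ m
⌈/4⌉-least 0 m _ = z≤n
⌈/4⌉-least 1 (suc m) _ = s≤s z≤n
⌈/4⌉-least 2 (suc m) _ = s≤s z≤n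
⌈/4⌉-least 3 (suc m) _ = s≤s z≤n
⌈/4⌉-least 4 (suc m) _ = s≤s z≤n
⌈/4⌉-least (suc (suc (suc (suc (suc d))))) (suc m) (s≤s (s≤s (s≤s (s≤s d<m*4)))) =
  s≤s (⌈/4⌉-least (suc d) m d<m*4)

-- (4 + d) % 4 reduces to d % 4, so the hypothesis is passed on unchanged.
⌈/4⌉-suc : ∀ d → d % 4 ≢ 0 → ⌈ d /4⌉ ≡ ⌈ suc d /4⌉
⌈/4⌉-suc 0 d≢0 = ⊥-elim (d≢0 refl)
⌈/4⌉-suc 1 _ = refl
⌈/4⌉-suc 2 _ = refl
⌈/4⌉-suc 3 _ = refl
⌈/4⌉-suc 4 d≢0 = ⊥-elim (d≢0 refl)
⌈/4⌉-suc (suc (suc (suc (suc (suc d))))) d≢0 = cong suc (⌈/4⌉-suc (suc d) d≢0)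

cycNorm : ℕ → ℕ → ℕ
cycNorm n g = g ⊓ (n ∸ g)

circDist : ℕ → ℕ → ℕ
circDist n g = ⌈ cycNorm n g /4⌉

module _ {n : ℕ} .{{_ : NonZero n}} where

  %-absorbˡ : ∀ a b → (a % n + b) % n ≡ (a + b) % n
  %-absorbˡ a b = begin
    (a % n + b) % n           ≡⟨ %-distribˡ-+ (a % n) b n ⟩
    (a % n % n + b % n) % n   ≡⟨ cong (λ z → (z + b % n) % n) (m%n%n≡m%n a n) ⟩
    (a % n + b % n) % n       ≡⟨ %-distribˡ-+ a b n ⟨
    (a + b) % n               ∎
    where open ≡-Reasoning

  +-%-cases : ∀ {a b} → a < n → b < n →
              (a + b < n × (a + b) % n ≡ a + b) ⊎ (n ≤ a + b × (a + b) % n ≡ a + b ∸ n)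
  +-%-cases {a} {b} a<n b<n with a + b <? n
  ... | yes a+b<n = inj₁ (a+b<n , m<n⇒m%n≡m a+b<n)
  ... | no a+b≮n = inj₂ (n≤a+b , trans (sym (m≤n⇒[n∸m]%m≡n%m n≤a+b)) (m<n⇒m%n≡m a+b∸n<n))
    where
    n≤a+b : n ≤ a + b
    n≤a+b = ≮⇒≥ a+b≮n
    a+b∸n<n : a + b ∸ n < n
    a+b∸n<n = ≤-<-trans (m≤n+o⇒m∸n≤o (a + b) n (+-monoˡ-≤ b (<⇒≤ a<n))) b<n

  [4+d]%n≡4+e⇒d≡e : ∀ {d e} → 4 < n → d < n → (4 + d) % n ≡ 4 + e → d ≡ e
  [4+d]%n≡4+e⇒d≡e {d} {e} 4<n d<n eq with +-%-cases 4<n d<n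
  ... | inj₁ (_ , eq′) = +-cancelˡ-≡ 4 d e (trans (sym eq′) eq)
  ... | inj₂ (_ , eq′) = ⊥-elim (<⇒≱ 4+d∸n<4 (≤-trans (m≤m+n 4 e) (≤-reflexive (trans (sym eq) eq′))))
    where
    4+d∸n<4 : 4 + d ∸ n < 4
    4+d∸n<4 = s≤s (m≤n+o⇒m∸n≤o (4 + d) n (subst (4 + d ≤_) (+-comm 3 n) (+-monoʳ-< 3 d<n)))

  cycNorm-+-≤ : ∀ {g s} → g < n → s < n → cycNorm n ((g + s) % n) ≤ cycNorm n g + s
  cycNorm-+-≤ {g} {s} g<n s<n with +-%-cases g<n s<n
  ... | inj₁ (g+s<n , eq) rewrite eq | +-distribʳ-⊓ s g (n ∸ g) =
    ⊓-monoʳ-≤ (g + s) (≤-trans (∸-monoʳ-≤ n (m≤m+n g s)) (m≤m+n (n ∸ g) s))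
  ... | inj₂ (n≤g+s , eq) rewrite eq = begin
    cycNorm n (g + s ∸ n)  ≤⟨ m⊓n≤m _ _ ⟩
    g + s ∸ n              ≤⟨ m≤n+o⇒m∸n≤o (g + s) n (+-monoˡ-≤ s (<⇒≤ g<n)) ⟩
    s                      ≤⟨ m≤n+m s _ ⟩
    cycNorm n g + s        ∎
    where open ≤-Reasoning

  cycNorm-≤-+ : ∀ {g s} → g < n → s < n → cycNorm n g ≤ cycNorm n ((g + s) % n) + s
  cycNorm-≤-+ {g} {s} g<n s<n with +-%-cases g<n s<n
  ... | inj₁ (g+s<n , eq) rewrite eq | +-distribʳ-⊓ s (g + s) (n ∸ (g + s)) =
    ⊓-mono-≤ (≤-trans (m≤m+n g s) (m≤m+n (g + s) s)) (≤-reflexive (sym n∸[g+s]+s≡n∸g))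
    where
    n∸[g+s]+s≡n∸g : n ∸ (g + s) + s ≡ n ∸ g
    n∸[g+s]+s≡n∸g = trans (cong (_+ s) (sym (∸-+-assoc n g s)))
                          (m∸n+n≡m (m+n≤o⇒m≤o∸n s (subst (_≤ n) (+-comm g s) (<⇒≤ g+s<n))))
  ... | inj₂ (n≤g+s , _) = begin
    cycNorm n g                 ≤⟨ m⊓n≤n g (n ∸ g) ⟩
    n ∸ g                       ≤⟨ m≤n+o⇒m∸n≤o n g n≤g+s ⟩
    s                           ≤⟨ m≤n+m s _ ⟩
    cycNorm n ((g + s) % n) + s ∎
    where open ≤-Reasoning

  diffMod<n : ∀ i j → diffMod n i j < n
  diffMod<n i j = m%n<n _ n

  private
    m+[n∸m]+k : ∀ (i : Fin n) k → toℕ i + (n ∸ toℕ i) + k ≡ k + n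
    m+[n∸m]+k i k = trans (cong (_+ k) (m+[n∸m]≡n (<⇒≤ (toℕ<n i)))) (+-comm n k)

  toℕ-+-diffMod : ∀ i j → (toℕ i + diffMod n i j) % n ≡ toℕ j
  toℕ-+-diffMod i j = begin
    (toℕ i + (toℕ j + (n ∸ toℕ i)) % n) % n   ≡⟨ cong (_% n) (+-comm (toℕ i) _) ⟩
    ((toℕ j + (n ∸ toℕ i)) % n + toℕ i) % n   ≡⟨ %-absorbˡ _ (toℕ i) ⟩
    (toℕ j + (n ∸ toℕ i) + toℕ i) % n         ≡⟨ cong (_% n) (+-assoc (toℕ j) _ _) ⟩
    (toℕ j + (n ∸ toℕ i + toℕ i)) % n         ≡⟨ cong (_% n) (+-comm (toℕ j) _) ⟩
    (n ∸ toℕ i + toℕ i + toℕ j) % n           ≡⟨ cong (λ z → (z + toℕ j) % n) (+-comm (n ∸ toℕ i) (toℕ i)) ⟩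
    (toℕ i + (n ∸ toℕ i) + toℕ j) % n         ≡⟨ cong (_% n) (m+[n∸m]+k i (toℕ j)) ⟩
    (toℕ j + n) % n                           ≡⟨ [m+n]%n≡m%n (toℕ j) n ⟩
    toℕ j % n                                 ≡⟨ m<n⇒m%n≡m (toℕ<n j) ⟩
    toℕ j                                     ∎
    where open ≡-Reasoning

  diffMod-unique : ∀ i j s → (toℕ i + s) % n ≡ toℕ j → diffMod n i j ≡ s % n
  diffMod-unique i j s eq = begin
    (toℕ j + (n ∸ toℕ i)) % n              ≡⟨ cong (λ z → (z + (n ∸ toℕ i)) % n) eq ⟨
    ((toℕ i + s) % n + (n ∸ toℕ i)) % n    ≡⟨ %-absorbˡ (toℕ i + s) _ ⟩
    (toℕ i + s + (n ∸ toℕ i)) % n          ≡⟨ cong (_% n) (+-comm-middle (toℕ i) s _) ⟩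
    (toℕ i + (n ∸ toℕ i) + s) % n          ≡⟨ cong (_% n) (m+[n∸m]+k i s) ⟩
    (s + n) % n                            ≡⟨ [m+n]%n≡m%n s n ⟩
    s % n                                  ∎
    where
    open ≡-Reasoning
    +-comm-middle : ∀ a b c → a + b + c ≡ a + c + b
    +-comm-middle a b c = trans (+-assoc a b c) (trans (cong (a +_) (+-comm b c)) (sym (+-assoc a c b)))

  diffMod-self : ∀ i → diffMod n i i ≡ 0
  diffMod-self i = trans (diffMod-unique i i 0 i+0%n≡i) (m<n⇒m%n≡m (>-nonZero⁻¹ n))
    where
    i+0%n≡i : (toℕ i + 0) % n ≡ toℕ i
    i+0%n≡i = trans (cong (_% n) (+-identityʳ (toℕ i))) (m<n⇒m%n≡m (toℕ<n i))

  diffMod≡0⇒≡ : ∀ {i j} → diffMod n i j ≡ 0 → i ≡ j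
  diffMod≡0⇒≡ {i} {j} d≡0 = toℕ-injective (begin
    toℕ i                       ≡⟨ m<n⇒m%n≡m (toℕ<n i) ⟨
    toℕ i % n                   ≡⟨ cong (_% n) (+-identityʳ (toℕ i)) ⟨
    (toℕ i + 0) % n             ≡⟨ cong (λ z → (toℕ i + z) % n) d≡0 ⟨
    (toℕ i + diffMod n i j) % n ≡⟨ toℕ-+-diffMod i j ⟩
    toℕ j                       ∎)
    where open ≡-Reasoning

  diffMod-trans : ∀ i j k → diffMod n i k ≡ (diffMod n i j + diffMod n j k) % n
  diffMod-trans i j k = diffMod-unique i k _ (begin
    (toℕ i + (diffMod n i j + diffMod n j k)) % n  ≡⟨ cong (_% n) (+-assoc (toℕ i) _ _) ⟨
    (toℕ i + diffMod n i j + diffMod n j k) % n    ≡⟨ %-absorbˡ (toℕ i + _) _ ⟨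
    ((toℕ i + diffMod n i j) % n + diffMod n j k) % n
                                                   ≡⟨ cong (λ z → (z + diffMod n j k) % n) (toℕ-+-diffMod i j) ⟩
    (toℕ j + diffMod n j k) % n                    ≡⟨ toℕ-+-diffMod j k ⟩
    toℕ k                                          ∎)
    where open ≡-Reasoning

  -- The two offsets are positive, below n, and sum to 0 modulo n.
  diffMod-sym : ∀ {i j} → i ≢ j → diffMod n i j + diffMod n j i ≡ n
  diffMod-sym {i} {j} i≢j with +-%-cases (diffMod<n i j) (diffMod<n j i)
                           | trans (sym (diffMod-trans i j i)) (diffMod-self i)
  ... | inj₁ (_ , eq) | sum%n≡0 = ⊥-elim (i≢j (diffMod≡0⇒≡ (m+n≡0⇒m≡0 _ (trans (sym eq) sum%n≡0))))
  ... | inj₂ (n≤sum , eq) | sum%n≡0 = ≤-antisym (m∸n≡0⇒m≤n (trans (sym eq) sum%n≡0)) n≤sum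

  diffMod-shift : ∀ x a p → diffMod n x (shift n a p) ≡ (diffMod n x a + p) % n
  diffMod-shift x a p = diffMod-unique x (shift n a p) _ (begin
    (toℕ x + (diffMod n x a + p)) % n   ≡⟨ cong (_% n) (+-assoc (toℕ x) _ p) ⟨
    (toℕ x + diffMod n x a + p) % n     ≡⟨ %-absorbˡ (toℕ x + _) p ⟨
    ((toℕ x + diffMod n x a) % n + p) % n ≡⟨ cong (λ z → (z + p) % n) (toℕ-+-diffMod x a) ⟩
    (toℕ a + p) % n                     ≡⟨ toℕ-fromℕ< (m%n<n (toℕ a + p) n) ⟨
    toℕ (shift n a p)                   ∎)
    where open ≡-Reasoning

  shift-injective : ∀ (a : Fin n) {p q} → p < n → q < n → shift n a p ≡ shift n a q → p ≡ q
  shift-injective a {p} {q} p<n q<n eq = begin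
    p                             ≡⟨ m<n⇒m%n≡m p<n ⟨
    (0 + p) % n                   ≡⟨ cong (λ z → (z + p) % n) (diffMod-self a) ⟨
    (diffMod n a a + p) % n       ≡⟨ diffMod-shift a a p ⟨
    diffMod n a (shift n a p)     ≡⟨ cong (diffMod n a) eq ⟩
    diffMod n a (shift n a q)     ≡⟨ diffMod-shift a a q ⟩
    (diffMod n a a + q) % n       ≡⟨ cong (λ z → (z + q) % n) (diffMod-self a) ⟩
    (0 + q) % n                   ≡⟨ m<n⇒m%n≡m q<n ⟩
    q                             ∎
    where open ≡-Reasoning

  diffMod-flip : ∀ {i j} → i ≢ j → diffMod n j i ≡ n ∸ diffMod n i j
  diffMod-flip {i} {j} i≢j =
    trans (sym (m+n∸m≡n (diffMod n i j) _)) (cong (_∸ diffMod n i j) (diffMod-sym i≢j))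

module _ {n : ℕ} .{{_ : NonZero n}} (4<n : 4 < n) where

  private
    s<n : ∀ {s} → s ≤ 4 → s < n
    s<n s≤4 = ≤-<-trans s≤4 4<n

    n∸s<n : ∀ {s} → 1 ≤ s → s ≤ 4 → n ∸ s < n
    n∸s<n 1≤s s≤4 = ∸-monoʳ-< 1≤s (<⇒≤ (s<n s≤4))

  diffMod-minus : ∀ {i j s} → i ≢ j → 1 ≤ s → s ≤ 4 → diffMod n i j ≡ (n ∸ s) % n → diffMod n j i ≡ s
  diffMod-minus {i} {j} {s} i≢j 1≤s s≤4 eq = begin
    diffMod n j i            ≡⟨ diffMod-flip i≢j ⟩
    n ∸ diffMod n i j        ≡⟨ cong (n ∸_) (trans eq (m<n⇒m%n≡m (n∸s<n 1≤s s≤4))) ⟩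
    n ∸ (n ∸ s)              ≡⟨ m∸[m∸n]≡n (<⇒≤ (s<n s≤4)) ⟩
    s                        ∎
    where open ≡-Reasoning

  Adj-sym : ∀ {i j} → Adj n i j → Adj n j i
  Adj-sym {i} {j} (i≢j , plus s 1≤s s≤4 eq) = ≢-sym i≢j , minus s 1≤s s≤4 (begin
    diffMod n j i            ≡⟨ diffMod-flip i≢j ⟩
    n ∸ diffMod n i j        ≡⟨ cong (n ∸_) (trans eq (m<n⇒m%n≡m (s<n s≤4))) ⟩
    n ∸ s                    ≡⟨ m<n⇒m%n≡m (n∸s<n 1≤s s≤4) ⟨
    (n ∸ s) % n              ∎)
    where open ≡-Reasoning
  Adj-sym (i≢j , minus s 1≤s s≤4 eq) =
    ≢-sym i≢j , plus s 1≤s s≤4 (trans (diffMod-minus i≢j 1≤s s≤4 eq) (sym (m<n⇒m%n≡m (s<n s≤4))))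

  Walk-snoc : ∀ {u v w m} → Walk n u v m → Adj n v w → Walk n u w (suc m)
  Walk-snoc (here _)   v~w = step v~w (here _)
  Walk-snoc (step u~ W) v~w = step u~ (Walk-snoc W v~w)

  Walk-reverse : ∀ {u v m} → Walk n u v m → Walk n v u m
  Walk-reverse (here v)    = here v
  Walk-reverse (step u~ W) = Walk-snoc (Walk-reverse W) (Adj-sym u~)

  cycNorm-Adj : ∀ x {w w′} → Adj n w w′ → cycNorm n (diffMod n x w) ≤ cycNorm n (diffMod n x w′) + 4
  cycNorm-Adj x {w} {w′} (_ , plus s _ s≤4 eq) = begin
    cycNorm n (diffMod n x w)                          ≤⟨ cycNorm-≤-+ (diffMod<n x w) (s<n s≤4) ⟩
    cycNorm n ((diffMod n x w + s) % n) + s            ≡⟨ cong (λ z → cycNorm n z + s) (sym x→w′) ⟩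
    cycNorm n (diffMod n x w′) + s                     ≤⟨ +-monoʳ-≤ _ s≤4 ⟩
    cycNorm n (diffMod n x w′) + 4                     ∎
    where
    open ≤-Reasoning
    x→w′ : diffMod n x w′ ≡ (diffMod n x w + s) % n
    x→w′ = trans (diffMod-trans x w w′)
                 (cong (λ z → (diffMod n x w + z) % n) (trans eq (m<n⇒m%n≡m (s<n s≤4))))
  cycNorm-Adj x {w} {w′} (w≢w′ , minus s 1≤s s≤4 eq) = begin
    cycNorm n (diffMod n x w)                          ≡⟨ cong (cycNorm n) x→w ⟩
    cycNorm n ((diffMod n x w′ + s) % n)               ≤⟨ cycNorm-+-≤ (diffMod<n x w′) (s<n s≤4) ⟩
    cycNorm n (diffMod n x w′) + s                     ≤⟨ +-monoʳ-≤ _ s≤4 ⟩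
    cycNorm n (diffMod n x w′) + 4                     ∎
    where
    open ≤-Reasoning
    x→w : diffMod n x w ≡ (diffMod n x w′ + s) % n
    x→w = trans (diffMod-trans x w′ w)
                (cong (λ z → (diffMod n x w′ + z) % n) (diffMod-minus w≢w′ 1≤s s≤4 eq))

  cycNorm-Walk : ∀ {w x m} → Walk n w x m → cycNorm n (diffMod n x w) ≤ m * 4
  cycNorm-Walk (here w) = ≤-reflexive (cong (cycNorm n) (diffMod-self w))
  cycNorm-Walk {w} {x} {suc m} (step {v = v} w~v W) = begin
    cycNorm n (diffMod n x w)      ≤⟨ cycNorm-Adj x w~v ⟩
    cycNorm n (diffMod n x v) + 4  ≤⟨ +-monoˡ-≤ 4 (cycNorm-Walk W) ⟩
    m * 4 + 4                      ≡⟨ +-comm (m * 4) 4 ⟩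
    suc m * 4                      ∎
    where open ≤-Reasoning

  Adj-forward : ∀ {w x s} → diffMod n w x ≡ s → 1 ≤ s → s ≤ 4 → Adj n w x
  Adj-forward {w} {x} {s} eq 1≤s s≤4 = w≢x , plus s 1≤s s≤4 (trans eq (sym (m<n⇒m%n≡m (s<n s≤4))))
    where
    w≢x : w ≢ x
    w≢x refl = <⇒≢ 1≤s (sym (trans (sym eq) (diffMod-self w)))

  Walk-forward : ∀ e {w x} → diffMod n w x ≡ e → Walk n w x ⌈ e /4⌉
  Walk-forward 0 {w} eq = subst (λ z → Walk n w z 0) (diffMod≡0⇒≡ eq) (here w)
  Walk-forward 1 {x = x} eq = step (Adj-forward eq (s≤s z≤n) (s≤s z≤n)) (here x)
  Walk-forward 2 {x = x} eq = step (Adj-forward eq (s≤s z≤n) (s≤s (s≤s z≤n))) (here x)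
  Walk-forward 3 {x = x} eq = step (Adj-forward eq (s≤s z≤n) (s≤s (s≤s (s≤s z≤n)))) (here x)
  Walk-forward 4 {x = x} eq = step (Adj-forward eq (s≤s z≤n) ≤-refl) (here x)
  Walk-forward (suc (suc (suc (suc (suc e))))) {w} {x} eq =
    step (Adj-forward w→v (s≤s z≤n) ≤-refl) (Walk-forward (suc e) v→x)
    where
    v : Fin n
    v = shift n w 4
    w→v : diffMod n w v ≡ 4
    w→v = trans (diffMod-shift w w 4) (trans (cong (λ z → (z + 4) % n) (diffMod-self w)) (m<n⇒m%n≡m 4<n))
    v→x : diffMod n v x ≡ suc e
    v→x = [4+d]%n≡4+e⇒d≡e 4<n (diffMod<n v x)
            (trans (cong (λ z → (z + diffMod n v x) % n) (sym w→v)) (trans (sym (diffMod-trans w v x)) eq))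

  Walk-circDist : ∀ u x → Walk n u x (circDist n (diffMod n x u))
  Walk-circDist u x with diffMod n x u ≤? n ∸ diffMod n x u
  ... | yes x→u≤u→x rewrite m≤n⇒m⊓n≡m x→u≤u→x = Walk-reverse (Walk-forward _ refl)
  ... | no x→u≰u→x rewrite m≥n⇒m⊓n≡n (<⇒≤ (≰⇒> x→u≰u→x)) =
    subst (λ z → Walk n u x ⌈ z /4⌉) (diffMod-flip x≢u) (Walk-forward _ refl)
    where
    x≢u : x ≢ u
    x≢u refl = x→u≰u→x (subst (_≤ n ∸ diffMod n x x) (sym (diffMod-self x)) z≤n)

  circDist-≤-Walk : ∀ {u x m} → Walk n u x m → circDist n (diffMod n x u) ≤ m
  circDist-≤-Walk {m = m} W = ⌈/4⌉-least _ m (cycNorm-Walk W)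

  Dist-circDist : ∀ u x → Dist n u x (circDist n (diffMod n x u))
  Dist-circDist u x = Walk-circDist u x , λ _ → circDist-≤-Walk

  Dist⇒≡circDist : ∀ {u x m} → Dist n u x m → m ≡ circDist n (diffMod n x u)
  Dist⇒≡circDist {u} {x} (W , shortest) = ≤-antisym (shortest _ (Walk-circDist u x)) (circDist-≤-Walk W)

  SameRep-⊆⁅⁆ : ∀ {X x u v} → X ⊆ ⁅ x ⁆ →
                circDist n (diffMod n x u) ≡ circDist n (diffMod n x v) → SameRep n X u v
  SameRep-⊆⁅⁆ X⊆⁅x⁆ eq y y∈X m with x∈⁅y⁆⇒x≡y _ (X⊆⁅x⁆ y∈X)
  ... | refl = transfer eq , transfer (sym eq)
    where
    transfer : ∀ {u v} → circDist n (diffMod n y u) ≡ circDist n (diffMod n y v) →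
               Dist n u y m → Dist n v y m
    transfer {u} {v} eq d = subst (Dist n v y) (sym (trans (Dist⇒≡circDist d) eq)) (Dist-circDist v y)

Collision : (ℕ → ℕ) → Set
Collision f = f 0 ≡ f 1 ⊎ f 5 ≡ f 6 ⊎ f 1 ≡ f 6 ⊎ f 0 ≡ f 5

-- n = 2h + 1 with h = 4k + 1, k = k′ + 1; h is the largest value of cycNorm n.
module Order8k+3 (k′ : ℕ) where

  open ≡-Reasoning

  h : ℕ
  h = 5 + k′ * 4

  n : ℕ
  n = suc (h + h)

  ρ : ℕ → ℕ
  ρ s = circDist n (s % n)

  ρ-low : ∀ {s} → s ≤ h → ρ s ≡ ⌈ s /4⌉
  ρ-low {s} s≤h = cong ⌈_/4⌉ (begin
    cycNorm n (s % n)  ≡⟨ cong (cycNorm n) (m<n⇒m%n≡m (s≤s (≤-trans s≤h (m≤m+n h h)))) ⟩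
    s ⊓ (n ∸ s)        ≡⟨ m≤n⇒m⊓n≡m (m+n≤o⇒m≤o∸n s (≤-trans (+-mono-≤ s≤h s≤h) (n≤1+n _))) ⟩
    s                  ∎)

  ρ-high : ∀ {s u} → s + u ≡ n → u ≤ h → ρ s ≡ ⌈ u /4⌉
  ρ-high {s} {zero} s+0≡n _ =
    cong (circDist n) (trans (cong (_% n) (trans (sym (+-identityʳ s)) s+0≡n)) (n%n≡0 n))
  ρ-high {s} {suc u} s+u≡n u≤h = cong ⌈_/4⌉ (begin
    cycNorm n (s % n)  ≡⟨ cong (cycNorm n) (m<n⇒m%n≡m s<n) ⟩
    s ⊓ (n ∸ s)        ≡⟨ cong (s ⊓_) n∸s≡u ⟩
    s ⊓ suc u          ≡⟨ m≥n⇒m⊓n≡n u<s ⟩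
    suc u              ∎)
    where
    s<n : s < n
    s<n = subst (s <_) s+u≡n (m<m+n s (s≤s z≤n))
    n∸s≡u : n ∸ s ≡ suc u
    n∸s≡u = trans (cong (_∸ s) (sym s+u≡n)) (m+n∸m≡n s (suc u))
    u<s : suc u ≤ s
    u<s = +-cancelʳ-≤ (suc u) (suc u) s
            (≤-trans (+-mono-≤ u≤h u≤h) (≤-trans (n≤1+n _) (≤-reflexive (sym s+u≡n))))

  ρ-wrap : ∀ {s w} → s ≡ w + n → w ≤ h → ρ s ≡ ⌈ w /4⌉
  ρ-wrap {s} {w} s≡w+n w≤h =
    trans (cong (circDist n) (trans (cong (_% n) s≡w+n) ([m+n]%n≡m%n w n))) (ρ-low w≤h)

  ρ-middle : ∀ {s} → s ≡ h → ρ s ≡ ρ (suc s)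
  ρ-middle refl = trans (ρ-low ≤-refl) (sym (ρ-high {suc h} {h} refl ≤-refl))

  private
    1≢0 : 1 ≢ 0
    1≢0 ()

    +-shift : ∀ {t} j u → t + (j + u) ≡ n → j + t + u ≡ n
    +-shift {t} j u eq = trans (trans (cong (_+ u) (+-comm j t)) (+-assoc t j u)) eq

    4≤h : 4 ≤ h
    4≤h = s≤s (s≤s (s≤s (s≤s z≤n)))

    h%4≡1 : h % 4 ≡ 1
    h%4≡1 = [m+kn]%n≡m%n 5 k′ 4

    gap≡1 : ∀ {t} d → t + d ≡ h → d ≤ 4 → d % 4 ≡ 1 → suc t ≡ h
    gap≡1 {t} 1 t+1≡h _ _ = trans (+-comm 1 t) t+1≡h
    gap≡1 0 _ _ ()
    gap≡1 2 _ _ ()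
    gap≡1 3 _ _ ()
    gap≡1 4 _ _ ()
    gap≡1 (suc (suc (suc (suc (suc _))))) _ (s≤s (s≤s (s≤s (s≤s ())))) _

  -- h ≡ 1 (mod 4), so the only multiple of 4 in [h - 4, h) is h - 1.
  last-multiple-of-4 : ∀ {t} → t % 4 ≡ 0 → t < h → h ≤ 4 + t → suc t ≡ h
  last-multiple-of-4 {t} t%4≡0 t<h h≤4+t = gap≡1 (h ∸ t) t+d≡h d≤4 (begin
      (h ∸ t) % 4        ≡⟨ %-remove-+ˡ (h ∸ t) (m%n≡0⇒n∣m t 4 t%4≡0) ⟨
      (t + (h ∸ t)) % 4  ≡⟨ cong (_% 4) t+d≡h ⟩
      h % 4              ≡⟨ h%4≡1 ⟩
      1                  ∎)
    where
    t+d≡h : t + (h ∸ t) ≡ h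
    t+d≡h = m+[n∸m]≡n (<⇒≤ t<h)
    d≤4 : h ∸ t ≤ 4
    d≤4 = +-cancelˡ-≤ t _ _ (subst (_≤ t + 4) (sym t+d≡h) (subst (h ≤_) (+-comm 4 t) h≤4+t))

  ρ-past-middle : ρ (9 + k′ * 4) ≡ ρ (10 + k′ * 4)
  ρ-past-middle = begin
    ρ (9 + k′ * 4)     ≡⟨ ρ-high {9 + k′ * 4} (9+m+[2+m]≡n k′) (+-monoˡ-≤ (k′ * 4) (s≤s (s≤s z≤n))) ⟩
    ⌈ 2 + k′ * 4 /4⌉   ≡⟨ ⌈/4⌉-suc (1 + k′ * 4) 1+m%4≢0 ⟨
    ⌈ 1 + k′ * 4 /4⌉   ≡⟨ ρ-high {10 + k′ * 4} (10+m+[1+m]≡n k′) (+-monoˡ-≤ (k′ * 4) (s≤s z≤n)) ⟨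
    ρ (10 + k′ * 4)    ∎
    where
    9+m+[2+m]≡n : ∀ k′ → 9 + k′ * 4 + (2 + k′ * 4) ≡ suc (5 + k′ * 4 + (5 + k′ * 4))
    9+m+[2+m]≡n = solve-∀
    10+m+[1+m]≡n : ∀ k′ → 10 + k′ * 4 + (1 + k′ * 4) ≡ suc (5 + k′ * 4 + (5 + k′ * 4))
    10+m+[1+m]≡n = solve-∀
    1+m%4≢0 : (1 + k′ * 4) % 4 ≢ 0
    1+m%4≢0 eq = 1≢0 (trans (sym ([m+kn]%n≡m%n 1 k′ 4)) eq)

  collision-low : ∀ t → t ≤ h → Collision (λ i → ρ (i + t))
  collision-low t t≤h with t ≟ h
  ... | yes t≡h = inj₁ (ρ-middle t≡h)
  ... | no t≢h with t % 4 ≟ 0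
  ...   | no t%4≢0 = inj₁ (begin
    ρ t                ≡⟨ ρ-low t≤h ⟩
    ⌈ t /4⌉            ≡⟨ ⌈/4⌉-suc t t%4≢0 ⟩
    ⌈ suc t /4⌉        ≡⟨ ρ-low (≤∧≢⇒< t≤h t≢h) ⟨
    ρ (1 + t)          ∎)
  ...   | yes t%4≡0 with 6 + t ≤? h
  ...     | yes 6+t≤h = inj₂ (inj₁ (begin
    ρ (5 + t)          ≡⟨ ρ-low (<⇒≤ 6+t≤h) ⟩
    ⌈ 5 + t /4⌉        ≡⟨ ⌈/4⌉-suc (5 + t) 5+t%4≢0 ⟩
    ⌈ 6 + t /4⌉        ≡⟨ ρ-low 6+t≤h ⟨
    ρ (6 + t)          ∎))
    where
    5+t%4≢0 : (5 + t) % 4 ≢ 0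
    5+t%4≢0 eq = 1≢0 (trans (sym (%-remove-+ʳ 1 (m%n≡0⇒n∣m t 4 t%4≡0))) eq)
  ...     | no 6+t≰h with 5 + t ≟ h
  ...       | yes 5+t≡h = inj₂ (inj₁ (ρ-middle 5+t≡h))
  ...       | no 5+t≢h =
    inj₂ (inj₁ (subst (λ s → ρ (5 + s) ≡ ρ (6 + s)) (sym t≡4+k′*4) ρ-past-middle))
    where
    h≤4+t : h ≤ 4 + t
    h≤4+t = s≤s⁻¹ (≤∧≢⇒< (s≤s⁻¹ (≰⇒> 6+t≰h)) (≢-sym 5+t≢h))
    t≡4+k′*4 : t ≡ 4 + k′ * 4
    t≡4+k′*4 = suc-injective (last-multiple-of-4 t%4≡0 (≤∧≢⇒< t≤h t≢h) h≤4+t)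

  private
    collision-high-4∣ : ∀ t v → t + suc v ≡ n → v < h → v % 4 ≡ 0 → Collision (λ i → ρ (i + t))
    collision-high-4∣ t 0 t+1≡n _ _ = inj₂ (inj₂ (inj₂ (begin
      ρ t              ≡⟨ ρ-high t+1≡n (s≤s z≤n) ⟩
      ⌈ 1 /4⌉          ≡⟨⟩
      ⌈ 4 /4⌉          ≡⟨ ρ-wrap (cong (4 +_) (trans (+-comm 1 t) t+1≡n)) 4≤h ⟨
      ρ (5 + t)        ∎)))
    collision-high-4∣ t 4 t+5≡n _ _ = inj₂ (inj₂ (inj₁ (begin
      ρ (1 + t)        ≡⟨ ρ-high {1 + t} (+-shift 1 4 t+5≡n) 4≤h ⟩
      ⌈ 4 /4⌉          ≡⟨⟩
      ⌈ 1 /4⌉          ≡⟨ ρ-wrap (cong (1 +_) (trans (+-comm 5 t) t+5≡n)) (s≤s z≤n) ⟨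
      ρ (6 + t)        ∎)))
    collision-high-4∣ _ 1 _ _ ()
    collision-high-4∣ _ 2 _ _ ()
    collision-high-4∣ _ 3 _ _ ()
    collision-high-4∣ t (suc (suc (suc (suc (suc w))))) eq 5+w<h 1+w%4≡0 = inj₂ (inj₁ (begin
      ρ (5 + t)        ≡⟨ ρ-high {5 + t} (+-shift 5 (suc w) eq) (m+n≤o⇒n≤o 4 (<⇒≤ 5+w<h)) ⟩
      ⌈ suc w /4⌉      ≡⟨ ⌈/4⌉-suc w w%4≢0 ⟨
      ⌈ w /4⌉          ≡⟨ ρ-high {6 + t} (+-shift 6 w eq) (m+n≤o⇒n≤o 5 (<⇒≤ 5+w<h)) ⟨
      ρ (6 + t)        ∎))
      where
      w%4≢0 : w % 4 ≢ 0
      w%4≢0 w%4≡0 = 1≢0 (trans (sym (%-remove-+ʳ 1 (m%n≡0⇒n∣m w 4 w%4≡0))) 1+w%4≡0)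

  collision-high : ∀ t v → t + suc v ≡ n → v < h → Collision (λ i → ρ (i + t))
  collision-high t v eq v<h with v % 4 ≟ 0
  ... | yes v%4≡0 = collision-high-4∣ t v eq v<h v%4≡0
  ... | no v%4≢0 = inj₁ (begin
    ρ t                ≡⟨ ρ-high eq v<h ⟩
    ⌈ suc v /4⌉        ≡⟨ ⌈/4⌉-suc v v%4≢0 ⟨
    ⌈ v /4⌉            ≡⟨ ρ-high {1 + t} (+-shift 1 v eq) (<⇒≤ v<h) ⟨
    ρ (1 + t)          ∎)

  collision : ∀ t → t < n → Collision (λ i → ρ (i + t))
  collision t t<n with t ≤? h
  ... | yes t≤h = collision-low t t≤h
  ... | no t≰h = collision-high t (n ∸ suc t) (trans (+-suc t _) (m+[n∸m]≡n t<n)) n∸[1+t]<h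
    where
    t≤h+h : t ≤ h + h
    t≤h+h = s≤s⁻¹ t<n
    n∸[1+t]<h : h + h ∸ t < h
    n∸[1+t]<h = subst (h + h ∸ t <_) (m+n∸n≡m h h) (∸-monoʳ-< (≰⇒> t≰h) t≤h+h)

∣X∣≤1⇒⊆⁅⁆ : ∀ {m} (X : Subset m) → ∣ X ∣ ≤ 1 → Fin m → Σ (Fin m) λ x → X ⊆ ⁅ x ⁆
∣X∣≤1⇒⊆⁅⁆ X ∣X∣≤1 x₀ with nonempty? X
... | no X-empty = x₀ , λ y∈X → ⊥-elim (X-empty (_ , y∈X))
... | yes (x , x∈X) = x , λ {y} y∈X → x∈⁅y⁆⇔x≡y .Equivalence.from (y≡x y∈X)
  where
  y≡x : ∀ {y} → y ∈ X → y ≡ x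
  y≡x {y} y∈X with y Fin.≟ x
  ... | yes y≡x = y≡x
  ... | no y≢x = ⊥-elim (<-irrefl refl (begin-strict
    1                ≡⟨ ∣⁅x⁆∣≡1 y ⟨
    ∣ ⁅ y ⁆ ∣        ≤⟨ p⊆q⇒∣p∣≤∣q∣ ⁅y⁆⊆X-x ⟩
    ∣ (X - x) ∣      <⟨ x∈p⇒∣p-x∣<∣p∣ x∈X ⟩
    ∣ X ∣            ≤⟨ ∣X∣≤1 ⟩
    1                ∎))
    where
    open ≤-Reasoning
    ⁅y⁆⊆X-x : ⁅ y ⁆ ⊆ X - x
    ⁅y⁆⊆X-x z∈⁅y⁆ = subst (_∈ X - x) (sym (x∈⁅y⁆⇒x≡y y z∈⁅y⁆)) (x∈p∧x≢y⇒x∈p-y y∈X y≢x)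

module _ (k′ : ℕ) where
  open Order8k+3 k′

  private
    4<n : 4 < n
    4<n = s≤s (s≤s (s≤s (s≤s (s≤s z≤n))))

    0<n : 0 < n
    0<n = s≤s z≤n

    1<n : 1 < n
    1<n = s≤s (s≤s z≤n)

    6<n : 6 < n
    6<n = s≤s (≤-trans (m≤m+n 6 4) (+-mono-≤ (m≤m+n 5 (k′ * 4)) (m≤m+n 5 (k′ * 4))))

    5<n : 5 < n
    5<n = <⇒≤ 6<n

  module _ (a x : Fin n) {X : Subset n} (X⊆⁅x⁆ : X ⊆ ⁅ x ⁆) (resolves : Resolves n X (InA n a)) where

    private
      t : ℕ
      t = diffMod n x a

      ρ-shift : ∀ p → circDist n (diffMod n x (shift n a p)) ≡ ρ (p + t)
      ρ-shift p = cong (circDist n) (trans (diffMod-shift x a p) (cong (_% n) (+-comm t p)))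

      clash : ∀ {p q} → p < n → q < n → InA n a (shift n a p) → InA n a (shift n a q) → p ≢ q →
              ρ (p + t) ≢ ρ (q + t)
      clash {p} {q} p<n q<n p∈A q∈A p≢q eq = resolves _ _ p∈A q∈A (p≢q ∘ shift-injective a p<n q<n)
        (SameRep-⊆⁅⁆ 4<n X⊆⁅x⁆ (trans (ρ-shift p) (trans eq (sym (ρ-shift q)))))

    single-landmark-unresolving : ⊥
    single-landmark-unresolving with collision t (diffMod<n x a)
    ... | inj₁ eq               = clash 0<n 1<n (inj₁ refl) (inj₂ (inj₁ refl)) (λ ()) eq
    ... | inj₂ (inj₁ eq)        = clash 5<n 6<n (inj₂ (inj₂ (inj₁ refl))) (inj₂ (inj₂ (inj₂ refl))) (λ ()) eq
    ... | inj₂ (inj₂ (inj₁ eq)) = clash 1<n 6<n (inj₂ (inj₁ refl)) (inj₂ (inj₂ (inj₂ refl))) (λ ()) eq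
    ... | inj₂ (inj₂ (inj₂ eq)) = clash 0<n 5<n (inj₁ refl) (inj₂ (inj₂ (inj₁ refl))) (λ ()) eq

resolving-set-≥2 : ∀ k′ {N} .{{_ : NonZero N}} → N ≡ Order8k+3.n k′ →
                   (a : Fin N) (X : Subset N) → Resolves N X (InA N a) → 2 ≤ ∣ X ∣
resolving-set-≥2 k′ refl a X resolves with 2 ≤? ∣ X ∣
... | yes 2≤∣X∣ = 2≤∣X∣
... | no 2≰∣X∣ with ∣X∣≤1⇒⊆⁅⁆ X (s≤s⁻¹ (≰⇒> 2≰∣X∣)) a
...   | x , X⊆⁅x⁆ = ⊥-elim (single-landmark-unresolving k′ a x X⊆⁅x⁆ resolves)

lemma3p21 : (k : ℕ) → 1 ≤ k → (a : Fin (3 + 8 * k)) → (X : Subset (3 + 8 * k))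
    → Resolves (3 + 8 * k) X (InA (3 + 8 * k) a) → 2 ≤ ∣ X ∣
lemma3p21 (suc k′) _ = resolving-set-≥2 k′ (3+8k≡2h+1 k′)
  where
  3+8k≡2h+1 : ∀ k′ → 3 + 8 * suc k′ ≡ suc (5 + k′ * 4 + (5 + k′ * 4))
  3+8k≡2h+1 = solve-∀
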